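{- Let $H$ be a graph possibly with loops and let $G$ be a finite multigraph without loops with an $H$-coloring $c$. Then $G_x$ has a perfect matching for every $x\in V(G)$ if and only if there exists a partition of $E(G)$ into closed $H$-trails.
   Context: An $H$-coloring of $G$ is a map $c:E(G)\to V(H)$. For $u\in V(G)$, $G_u$ is the simple graph whose vertex set is the set of edges of $G$ incident with $u$, two distinct such edges $a,b$ being adjacent iff $c(a)c(b)\in E(H)$ (here $ab\in E(H)$ means $a,b$ adjacent in $H$, a loop being required when $a=b$). An $H$-walk in $G$ is a walk $W=(v_0,e_0,v_1,e_1,\ldots,e_{k-1},v_k)$ (each $e_i$ an edge joining $v_i$ and $v_{i+1}$) such that $c(e_i)c(e_{i+1})\in E(H)$ for every $i\in\{0,\ldots,k-2\}$; it is closed if $v_0=v_k$ and $c(e_{k-1})c(e_0)\in E(H)$. An $H$-trail is an $H$-walk with no repeated edge. A partition of $E(G)$ into closed $H$-trails is a family of closed $H$-trails whose edge sets partition $E(G)$. -}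

module Defs where

open import Level using (Level; _⊔_)
open import Data.Nat using (ℕ; zero; suc; _≥_)
open import Data.Fin using (Fin; inject₁) renaming (suc to fsuc; zero to fzero)
open import Data.Fin.Properties using ()
open import Data.Product using (Σ; ∃; ∃-syntax; _×_; _,_; proj₁; proj₂)
open import Data.Sum using (_⊎_)
open import Relation.Binary.PropositionalEquality using (_≡_)
open import Relation.Nullary using (¬_)
open import Function.Definitions using (Injective)

record LoopGraph (ℓv ℓe : Level) : Set (Level.suc (ℓv ⊔ ℓe)) where
  field
    V    : Set ℓv
    E    : V → V → Set ℓe
    sym  : ∀ {a b} → E a b → E b a

record Multigraph : Set where
  field
    n      : ℕ
    m      : ℕ
    end₁   : Fin m → Fin n
    end₂   : Fin m → Fin n
    noLoop : ∀ e → ¬ (end₁ e ≡ end₂ e)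

module _ {ℓv ℓe : Level} (H : LoopGraph ℓv ℓe) (G : Multigraph) where
  open LoopGraph H
  open Multigraph G

  HColoring : Set ℓv
  HColoring = Fin m → V

  Incident : Fin n → Fin m → Set
  Incident u e = (end₁ e ≡ u) ⊎ (end₂ e ≡ u)

  Joins : Fin m → Fin n → Fin n → Set
  Joins e u v = (end₁ e ≡ u × end₂ e ≡ v) ⊎ (end₁ e ≡ v × end₂ e ≡ u)

  module _ (c : HColoring) where

    -- adjacency in G_u: distinct edges a b incident with u with c(a)c(b) ∈ E(H)
    AdjAt : Fin n → Fin m → Fin m → Set ℓe
    AdjAt u a b = Incident u a × Incident u b × ¬ (a ≡ b) × E (c a) (c b)

    -- A perfect matching of G_u: a set M of edges of G_u (unordered pairs,
    -- represented by a symmetric relation) such that every vertex of G_u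
    -- lies in exactly one edge of M.
    record PerfectMatchingAt (u : Fin n) : Set (Level.suc ℓe) where
      field
        M       : Fin m → Fin m → Set ℓe
        M-sym   : ∀ {a b} → M a b → M b a
        M-edge  : ∀ {a b} → M a b → AdjAt u a b
        covers  : ∀ a → Incident u a → ∃[ b ] M a b
        unique  : ∀ {a b b'} → M a b → M a b' → b ≡ b'

    -- A closed H-trail W = (v₀,e₀,v₁,…,e_{k-1},v_k), k ≥ 1.
    record ClosedHTrail : Set ℓe where
      field
        k        : ℕ
        k≥1      : k ≥ 1
        vs       : Fin (suc k) → Fin n
        es       : Fin k → Fin m
        joins    : ∀ (i : Fin k) → Joins (es i) (vs (inject₁ i)) (vs (fsuc i))
        hwalk    : ∀ (i : Fin k) (j : Fin k) → Data.Fin.toℕ j ≡ suc (Data.Fin.toℕ i) → E (c (es i)) (c (es j))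
        closedV  : vs fzero ≡ vs (Data.Fin.fromℕ k)
        closedE  : ∀ (i₀ iₗ : Fin k) → Data.Fin.toℕ i₀ ≡ 0 → suc (Data.Fin.toℕ iₗ) ≡ k → E (c (es iₗ)) (c (es i₀))
        trail    : Injective _≡_ _≡_ es

    -- A partition of E(G) into closed H-trails: a finite family of closed
    -- H-trails such that every edge lies in exactly one trail
    -- (at exactly one position, trails being edge-injective).
    record ClosedHTrailPartition : Set ℓe where
      field
        p       : ℕ
        T       : Fin p → ClosedHTrail
        cover   : ∀ (e : Fin m) → ∃[ j ] ∃[ i ] ClosedHTrail.es (T j) i ≡ e
        disjoint : ∀ (e : Fin m) (j j' : Fin p) i i' →
                   ClosedHTrail.es (T j) i ≡ e → ClosedHTrail.es (T j') i' ≡ e → j ≡ j'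

-- A perfect matching of G_x tells a walk that arrives at x along an edge a to leave along the
-- partner of a. On darts (oriented edges) this is a map next with next ∘ reverse ∘ next = reverse,
-- so next is injective, i.e. a permutation of the finite set of darts. Each cycle of next is a
-- closed H-trail: consecutive edges are matched, hence H-adjacent, and no edge is used twice, since
-- next^d s = reverse s is impossible (peel next ∘ reverse ∘ next = reverse off both ends until d ≤ 1).
-- The cycles through s and through reverse s carry the same edges, so one cycle for each such pair
-- (through the forward dart of the least edge on it) partitions E(G). Conversely, the pairs of
-- consecutive edges of the trails of a partition at their passages through x form a perfect
-- matching of G_x.
module Submission where

open import Defs
open import Level using (Level; Lift; lift)
open import Data.Bool using (Bool; true; false; not)
open import Data.Empty using (⊥; ⊥-elim)
open import Data.Fin as F using (Fin; toℕ; inject₁; fromℕ; fromℕ<; inject) renaming (zero to fzero; suc to fsuc)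
import Data.Fin.Properties as FP
open import Data.List using (List; filter; length; lookup; allFin)
import Data.List.Relation.Unary.All as All
open import Data.List.Relation.Unary.AllPairs using (_∷_)
open import Data.List.Relation.Unary.Any using (index)
open import Data.List.Relation.Unary.Any.Properties using (lookup-index)
open import Data.List.Relation.Unary.Unique.Propositional using (Unique)
import Data.List.Relation.Unary.Unique.Propositional.Properties as Unique
open import Data.List.Membership.Propositional using (_∈_)
open import Data.List.Membership.Propositional.Properties using (∈-filter⁺; ∈-filter⁻; ∈-allFin; ∈-lookup)
open import Data.Nat using (ℕ; zero; suc; _+_; _*_; _∸_; _≤_; _<_; z≤n; s≤s; pred)
open import Data.Nat.DivMod using (_%_; _/_; m%n<n; m≡m%n+[m/n]*n)
open import Data.Nat.GeneralisedArithmetic using (fold; fold-+)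
open import Data.Nat.Properties using (+-comm; *-comm; +-suc; <-irrefl; 0≢1+n; suc-injective; m≤n⇒m<n∨m≡n; m≤n⇒∃[o]m+o≡n; ≤-<-trans; m≤m+n; m∸n+n≡m; n<1+n)
open import Data.Product using (∃; ∃-syntax; _×_; _,_; proj₁; proj₂)
open import Data.Product.Function.NonDependent.Propositional using (_×-↔_)
open import Data.Sum using (_⊎_; inj₁; inj₂; swap)
open import Function.Base using (_∘_)
open import Function.Bundles using (_⇔_; _↣_; Injection; Equivalence; mk⇔)
open import Function.Construct.Composition using (_↔-∘_)
open import Function.Construct.Identity using (↔-id)
open import Function.Definitions using (Injective)
open import Function.Properties.Inverse using (↔-sym; ↔⇒↣)
open import Relation.Binary.Definitions using (DecidableEquality; tri<; tri≈; tri>)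
open import Relation.Binary.PropositionalEquality
open import Relation.Nullary using (¬_; Dec; does; yes; no; ¬?)
open import Relation.Nullary.Decidable using (map′; decidable-stable; _→-dec_)
open import Relation.Unary using (Pred; Decidable)


IsCyclicSuc : ∀ {k} → Fin k → Fin k → Set
IsCyclicSuc {k} i j = toℕ j ≡ suc (toℕ i) ⊎ (toℕ j ≡ 0 × suc (toℕ i) ≡ k)

cyclicSuc-functional : ∀ {k} {i j j′ : Fin k} → IsCyclicSuc i j → IsCyclicSuc i j′ → j ≡ j′
cyclicSuc-functional (inj₁ p) (inj₁ q) = FP.toℕ-injective (trans p (sym q))
cyclicSuc-functional {j = j} (inj₁ p) (inj₂ (_ , q)) = ⊥-elim (<-irrefl (trans p q) (FP.toℕ<n j))
cyclicSuc-functional {j′ = j′} (inj₂ (_ , p)) (inj₁ q) = ⊥-elim (<-irrefl (trans q p) (FP.toℕ<n j′))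
cyclicSuc-functional (inj₂ (p , _)) (inj₂ (q , _)) = FP.toℕ-injective (trans p (sym q))

cyclicSuc-injective : ∀ {k} {i i′ j : Fin k} → IsCyclicSuc i j → IsCyclicSuc i′ j → i ≡ i′
cyclicSuc-injective (inj₁ p) (inj₁ q) = FP.toℕ-injective (suc-injective (trans (sym p) q))
cyclicSuc-injective (inj₁ p) (inj₂ (q , _)) = ⊥-elim (0≢1+n (trans (sym q) p))
cyclicSuc-injective (inj₂ (p , _)) (inj₁ q) = ⊥-elim (0≢1+n (trans (sym p) q))
cyclicSuc-injective (inj₂ (_ , p)) (inj₂ (_ , q)) = FP.toℕ-injective (suc-injective (trans p (sym q)))

cyclicSuc-exists : ∀ {k} (i : Fin k) → ∃ (IsCyclicSuc i)
cyclicSuc-exists {suc k} i with m≤n⇒m<n∨m≡n (FP.toℕ<n i)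
... | inj₁ 1+i<k = fromℕ< 1+i<k , inj₁ (FP.toℕ-fromℕ< 1+i<k)
... | inj₂ 1+i≡k = fzero , inj₂ (refl , 1+i≡k)

cyclicPred-exists : ∀ {k} (j : Fin k) → ∃ λ i → IsCyclicSuc i j
cyclicPred-exists {suc k} fzero = fromℕ k , inj₂ (refl , cong suc (FP.toℕ-fromℕ k))
cyclicPred-exists (fsuc j) = inject₁ j , inj₁ (cong suc (sym (FP.toℕ-inject₁ j)))

<-distinct⇒injective : ∀ {a} {A : Set a} {k} (g : Fin k → A) → (∀ {i j} → i F.< j → g i ≢ g j) →
                       Injective _≡_ _≡_ g
<-distinct⇒injective g distinct {i} {j} gi≡gj with FP.<-cmp i j
... | tri< i<j _ _ = ⊥-elim (distinct i<j gi≡gj)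
... | tri≈ _ i≡j _ = i≡j
... | tri> _ _ j<i = ⊥-elim (distinct j<i (sym gi≡gj))

lookup-injective : ∀ {a} {A : Set a} {xs : List A} → Unique xs → Injective _≡_ _≡_ (lookup xs)
lookup-injective (_ ∷ _) {fzero} {fzero} _ = refl
lookup-injective (x∉xs ∷ _) {fzero} {fsuc j} x≡xⱼ = ⊥-elim (All.lookup x∉xs (∈-lookup j) x≡xⱼ)
lookup-injective (x∉xs ∷ _) {fsuc i} {fzero} xᵢ≡x = ⊥-elim (All.lookup x∉xs (∈-lookup i) (sym xᵢ≡x))
lookup-injective (_ ∷ unique) {fsuc i} {fsuc j} xᵢ≡xⱼ = cong fsuc (lookup-injective unique xᵢ≡xⱼ)

module Orbits {a} {A : Set a} {N : ℕ} (encode : A ↣ Fin N)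
              (f : A → A) (f-injective : Injective _≡_ _≡_ f) where

  open Injection encode using (to; injective)

  _≟_ : DecidableEquality A
  x ≟ y = map′ injective (cong to) (to x F.≟ to y)

  iter : ℕ → A → A
  iter k x = fold x f k

  iter-+ : ∀ k l x → iter (k + l) x ≡ iter k (iter l x)
  iter-+ k l x = fold-+ x f k

  iter-comm : ∀ k l x → iter k (iter l x) ≡ iter l (iter k x)
  iter-comm k l x = trans (sym (iter-+ k l x)) (trans (cong (λ j → iter j x) (+-comm k l)) (iter-+ l k x))

  iter-suc : ∀ k x → iter (suc k) x ≡ iter k (f x)
  iter-suc k x = iter-comm 1 k x

  iter-injective : ∀ k → Injective _≡_ _≡_ (iter k)
  iter-injective zero    eq = eq
  iter-injective (suc k) eq = iter-injective k (f-injective eq)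

  private
    Returns : A → ℕ → Set a
    Returns x t = iter (suc t) x ≡ x

  -- Nothing below depends on how the return time is found.
  opaque
    -- N + 1 iterates cannot all be distinct; injectivity moves the repetition back to x.
    returns : ∀ x → ∃ (Returns x)
    returns x with FP.pigeonhole (n<1+n N) (λ i → to (iter (toℕ i) x))
    ... | i , j , i<j , same with m≤n⇒∃[o]m+o≡n i<j
    ...   | t , 1+i+t≡j = t , sym (iter-injective (toℕ i) (begin
        iter (toℕ i) x                 ≡⟨ injective same ⟩
        iter (toℕ j) x                 ≡⟨ cong (λ l → iter l x) (sym 1+i+t≡j) ⟩
        iter (suc (toℕ i + t)) x       ≡⟨ cong (λ l → iter l x) (sym (+-suc (toℕ i) t)) ⟩
        iter (toℕ i + suc t) x         ≡⟨ iter-+ (toℕ i) (suc t) x ⟩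
        iter (toℕ i) (iter (suc t) x)  ∎))
      where open ≡-Reasoning

    firstReturn : ∀ x → ∃ λ t → Returns x t × (∀ {d} → d < t → ¬ Returns x d)
    firstReturn x = toℕ i , decidable-stable (Returns? (toℕ i)) ¬¬returns , earlier′
      where
      Returns? : ∀ t → Dec (Returns x t)
      Returns? t = iter (suc t) x ≟ x
      t₀ : ℕ
      t₀ = proj₁ (returns x)
      smallest : ∃ λ (i : Fin (suc t₀)) → ¬ ¬ Returns x (toℕ i) × ((j : F.Fin′ i) → ¬ Returns x (toℕ (inject j)))
      smallest = FP.¬∀⟶∃¬-smallest (suc t₀) (λ i → ¬ Returns x (toℕ i)) (λ i → ¬? (Returns? (toℕ i)))
        (λ never → never (fromℕ t₀) (subst (Returns x) (sym (FP.toℕ-fromℕ t₀)) (proj₂ (returns x))))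
      i : Fin (suc t₀)
      i = proj₁ smallest
      ¬¬returns : ¬ ¬ Returns x (toℕ i)
      ¬¬returns = proj₁ (proj₂ smallest)
      earlier′ : ∀ {d} → d < toℕ i → ¬ Returns x d
      earlier′ d<i = subst (λ l → ¬ Returns x l) (trans (FP.toℕ-inject (fromℕ< d<i)) (FP.toℕ-fromℕ< d<i))
                           (proj₂ (proj₂ smallest) (fromℕ< d<i))

  period : A → ℕ
  period x = suc (proj₁ (firstReturn x))

  iter-period : ∀ x → iter (period x) x ≡ x
  iter-period x = proj₁ (proj₂ (firstReturn x))

  iter-period-minimal : ∀ x d → suc d < period x → iter (suc d) x ≢ x
  iter-period-minimal x d (s≤s d<t) = proj₂ (proj₂ (firstReturn x)) d<t

  iter-*-period : ∀ q x → iter (q * period x) x ≡ x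
  iter-*-period zero    x = refl
  iter-*-period (suc q) x = begin
    iter (period x + q * period x) x        ≡⟨ iter-+ (period x) (q * period x) x ⟩
    iter (period x) (iter (q * period x) x) ≡⟨ cong (iter (period x)) (iter-*-period q x) ⟩
    iter (period x) x                       ≡⟨ iter-period x ⟩
    x                                       ∎
    where open ≡-Reasoning

  iter-mod-period : ∀ k x → iter k x ≡ iter (k % period x) x
  iter-mod-period k x = begin
    iter k x                                               ≡⟨ cong (λ l → iter l x) (m≡m%n+[m/n]*n k (period x)) ⟩
    iter (k % period x + k / period x * period x) x        ≡⟨ iter-+ (k % period x) _ x ⟩
    iter (k % period x) (iter (k / period x * period x) x) ≡⟨ cong (iter (k % period x)) (iter-*-period (k / period x) x) ⟩
    iter (k % period x) x                                  ∎
    where open ≡-Reasoning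

  iter-position : ∀ k x → ∃ λ (i : Fin (period x)) → iter k x ≡ iter (toℕ i) x
  iter-position k x = fromℕ< (m%n<n k (period x)) ,
    trans (iter-mod-period k x) (cong (λ l → iter l x) (sym (FP.toℕ-fromℕ< (m%n<n k (period x)))))

  iter-return : ∀ k x → iter (pred (period x) * k) (iter k x) ≡ x
  iter-return k x = begin
    iter (pred (period x) * k) (iter k x) ≡⟨ sym (iter-+ (pred (period x) * k) k x) ⟩
    iter (pred (period x) * k + k) x     ≡⟨ cong (λ l → iter l x) (+-comm (pred (period x) * k) k) ⟩
    iter (period x * k) x                ≡⟨ cong (λ l → iter l x) (*-comm (period x) k) ⟩
    iter (k * period x) x                ≡⟨ iter-*-period k x ⟩
    x                                    ∎
    where open ≡-Reasoning

  any-iter? : ∀ {p} {P : Pred A p} → Decidable P → ∀ x → Dec (∃ λ k → P (iter k x))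
  any-iter? {P = P} P? x = map′ (λ (i , p) → toℕ i , p) onCycle (FP.any? (λ i → P? (iter (toℕ i) x)))
    where
    onCycle : (∃ λ k → P (iter k x)) → ∃ λ (i : Fin (period x)) → P (iter (toℕ i) x)
    onCycle (k , p) = let (i , eq) = iter-position k x in i , subst P eq p

module _ {ℓv ℓe : Level} (H : LoopGraph ℓv ℓe) (G : Multigraph) (c : HColoring H G) where
  open LoopGraph H using (E) renaming (sym to E-sym)
  open Multigraph G

  joins⇒incident₁ : ∀ {e u v} → Joins H G e u v → Incident H G u e
  joins⇒incident₁ (inj₁ (p , _)) = inj₁ p
  joins⇒incident₁ (inj₂ (_ , q)) = inj₂ q

  joins⇒incident₂ : ∀ {e u v} → Joins H G e u v → Incident H G v e
  joins⇒incident₂ (inj₁ (_ , q)) = inj₂ q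
  joins⇒incident₂ (inj₂ (p , _)) = inj₁ p

  joins⇒distinct : ∀ {e u v} → Joins H G e u v → u ≢ v
  joins⇒distinct {e} (inj₁ (p , q)) u≡v = noLoop e (trans p (trans u≡v (sym q)))
  joins⇒distinct {e} (inj₂ (p , q)) u≡v = noLoop e (trans p (trans (sym u≡v) (sym q)))

  incident-joins : ∀ {e u v x} → Joins H G e u v → Incident H G x e → x ≡ u ⊎ x ≡ v
  incident-joins (inj₁ (p , _)) (inj₁ r) = inj₁ (trans (sym r) p)
  incident-joins (inj₁ (_ , q)) (inj₂ r) = inj₂ (trans (sym r) q)
  incident-joins (inj₂ (p , _)) (inj₁ r) = inj₂ (trans (sym r) p)
  incident-joins (inj₂ (_ , q)) (inj₂ r) = inj₁ (trans (sym r) q)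

  module _ (W : ClosedHTrail H G c) where
    open ClosedHTrail W

    vs-cyclicSuc : ∀ {i j} → IsCyclicSuc i j → vs (inject₁ j) ≡ vs (fsuc i)
    vs-cyclicSuc {i} {j} (inj₁ j≡1+i) = cong vs (FP.toℕ-injective (trans (FP.toℕ-inject₁ j) j≡1+i))
    vs-cyclicSuc {i} {j} (inj₂ (j≡0 , 1+i≡k)) = begin
      vs (inject₁ j) ≡⟨ cong vs (FP.toℕ-injective {j = fzero} (trans (FP.toℕ-inject₁ j) j≡0)) ⟩
      vs fzero       ≡⟨ closedV ⟩
      vs (fromℕ k)   ≡⟨ cong vs (FP.toℕ-injective (trans (FP.toℕ-fromℕ k) (sym 1+i≡k))) ⟩
      vs (fsuc i)    ∎
      where open ≡-Reasoning

    adjacent-cyclicSuc : ∀ {i j} → IsCyclicSuc i j → E (c (es i)) (c (es j))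
    adjacent-cyclicSuc {i} {j} (inj₁ j≡1+i)          = hwalk i j j≡1+i
    adjacent-cyclicSuc {i} {j} (inj₂ (j≡0 , 1+i≡k)) = closedE j i j≡0 1+i≡k

  module _ (P : ClosedHTrailPartition H G c) where
    open ClosedHTrailPartition P
    private
      module T (j : Fin p) = ClosedHTrail (T j)

    -- Some trail of the partition passes through x, arriving along a and leaving along b.
    Transition : Fin n → Fin m → Fin m → Set
    Transition x a b = ∃[ j ] ∃[ i ] ∃[ i′ ]
      IsCyclicSuc i i′ × T.es j i ≡ a × T.es j i′ ≡ b × T.vs j (fsuc i) ≡ x

    position-unique : ∀ {e j j′ i i′} → T.es j i ≡ e → T.es j′ i′ ≡ e →
                      _≡_ {A = ∃ λ j → Fin (T.k j)} (j , i) (j′ , i′)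
    position-unique {e} {j} {j′} {i} {i′} p q with disjoint e j j′ i i′ p q
    ... | refl = cong (j ,_) (T.trail j (trans p (sym q)))

    transition-incident : ∀ {x a b} → Transition x a b → Incident H G x a × Incident H G x b
    transition-incident (j , i , i′ , s , refl , refl , refl) =
      joins⇒incident₂ (T.joins j i) ,
      subst (λ v → Incident H G v (T.es j i′)) (vs-cyclicSuc (T j) s) (joins⇒incident₁ (T.joins j i′))

    transition-distinct : ∀ {x a b} → Transition x a b → a ≢ b
    transition-distinct (j , i , i′ , s , refl , refl , _) a≡b with refl ← T.trail j a≡b =
      joins⇒distinct (T.joins j i) (vs-cyclicSuc (T j) s)

    transition-adjacent : ∀ {x a b} → Transition x a b → E (c a) (c b)
    transition-adjacent (j , _ , _ , s , refl , refl , _) = adjacent-cyclicSuc (T j) s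

    transition-functional : ∀ {x a b b′} → Transition x a b → Transition x a b′ → b ≡ b′
    transition-functional (j , i , _ , s , refl , refl , _) (_ , _ , _ , s′ , a≡ , refl , _)
      with refl ← position-unique refl a≡ = cong (T.es j) (cyclicSuc-functional s s′)

    transition-injective : ∀ {x a a′ b} → Transition x a b → Transition x a′ b → a ≡ a′
    transition-injective (j , _ , i′ , s , refl , refl , _) (_ , _ , _ , s′ , refl , b≡ , _)
      with refl ← position-unique refl b≡ = cong (T.es j) (cyclicSuc-injective s s′)

    -- Otherwise both ends of a would be x.
    transition-arrive-leave : ∀ {x a b b′} → Transition x a b → Transition x b′ a → ⊥
    transition-arrive-leave (j , i , _ , _ , refl , refl , i→x) (_ , i₀ , _ , s₀ , refl , a≡ , i₀→x)
      with refl ← position-unique refl a≡ =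
      joins⇒distinct (T.joins j i) (trans (vs-cyclicSuc (T j) s₀) (trans i₀→x (sym i→x)))

    partition⇒perfectMatching : (x : Fin n) → PerfectMatchingAt H G c x
    partition⇒perfectMatching x = record
      { M      = λ a b → Lift ℓe (Transition x a b ⊎ Transition x b a)
      ; M-sym  = λ { (lift t) → lift (swap t) }
      ; M-edge = λ { (lift t) → matched-adjacent t }
      ; covers = covers
      ; unique = λ { (lift t) (lift t′) → matched-unique t t′ }
      }
      where
      matched-adjacent : ∀ {a b} → Transition x a b ⊎ Transition x b a → AdjAt H G c x a b
      matched-adjacent (inj₁ t) = let (ia , ib) = transition-incident t in
        ia , ib , transition-distinct t , transition-adjacent t
      matched-adjacent (inj₂ t) = let (ib , ia) = transition-incident t in
        ia , ib , transition-distinct t ∘ sym , E-sym (transition-adjacent t)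

      matched-unique : ∀ {a b b′} → Transition x a b ⊎ Transition x b a →
                       Transition x a b′ ⊎ Transition x b′ a → b ≡ b′
      matched-unique (inj₁ t) (inj₁ t′) = transition-functional t t′
      matched-unique (inj₁ t) (inj₂ t′) = ⊥-elim (transition-arrive-leave t t′)
      matched-unique (inj₂ t) (inj₁ t′) = ⊥-elim (transition-arrive-leave t′ t)
      matched-unique (inj₂ t) (inj₂ t′) = transition-injective t t′

      covers : ∀ a → Incident H G x a → ∃[ b ] Lift ℓe (Transition x a b ⊎ Transition x b a)
      covers a x∈a with cover a
      ... | j , i , i↦a with incident-joins (subst (λ e → Joins H G e _ _) i↦a (T.joins j i)) x∈a
      ...   | inj₁ x≡start = let (i₀ , s) = cyclicPred-exists i in
        T.es j i₀ , lift (inj₂ (j , i₀ , i , s , refl , i↦a , trans (sym (vs-cyclicSuc (T j) s)) (sym x≡start)))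
      ...   | inj₂ x≡end = let (i′ , s) = cyclicSuc-exists i in
        T.es j i′ , lift (inj₁ (j , i , i′ , s , i↦a , refl , sym x≡end))

  Dart : Set
  Dart = Fin m × Bool

  edge : Dart → Fin m
  edge = proj₁

  tail head : Dart → Fin n
  tail (e , false) = end₁ e
  tail (e , true)  = end₂ e
  head (e , false) = end₂ e
  head (e , true)  = end₁ e

  forward : Fin m → Dart
  forward e = e , false

  reverse : Dart → Dart
  reverse s = edge s , not (proj₂ s)

  reverse-involutive : ∀ s → reverse (reverse s) ≡ s
  reverse-involutive (e , false) = refl
  reverse-involutive (e , true)  = refl

  head-reverse : ∀ s → head (reverse s) ≡ tail s
  head-reverse (e , false) = refl
  head-reverse (e , true)  = refl

  reverse-≢ : ∀ s → reverse s ≢ s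
  reverse-≢ (e , false) ()
  reverse-≢ (e , true)  ()

  dart-joins : ∀ s → Joins H G (edge s) (tail s) (head s)
  dart-joins (e , false) = inj₁ (refl , refl)
  dart-joins (e , true)  = inj₂ (refl , refl)

  edge-≡ : ∀ {s t} → edge s ≡ edge t → t ≡ s ⊎ t ≡ reverse s
  edge-≡ {e , false} {e , false} refl = inj₁ refl
  edge-≡ {e , false} {e , true}  refl = inj₂ refl
  edge-≡ {e , true}  {e , false} refl = inj₂ refl
  edge-≡ {e , true}  {e , true}  refl = inj₁ refl

  -- The dart along b leaving v; meaningful only when v is an end of b.
  departing : Fin m → Fin n → Dart
  departing b v = b , not (does (end₁ b F.≟ v))

  dartCode : Dart ↣ Fin (m * 2)
  dartCode = ↔⇒↣ (↔-sym ((↔-id (Fin m) ×-↔ FP.2↔Bool) ↔-∘ FP.*↔×))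

  tail-departing : ∀ {b v} → Incident H G v b → tail (departing b v) ≡ v
  tail-departing {b} {v} v∈b with end₁ b F.≟ v | v∈b
  ... | yes end₁≡v | _         = end₁≡v
  ... | no  end₁≢v | inj₁ end₁≡v = ⊥-elim (end₁≢v end₁≡v)
  ... | no  _      | inj₂ end₂≡v = end₂≡v

  departing-head : ∀ s → departing (edge s) (head s) ≡ reverse s
  departing-head (e , false) with end₁ e F.≟ end₂ e
  ... | yes loop = ⊥-elim (noLoop e loop)
  ... | no  _    = refl
  departing-head (e , true) with end₁ e F.≟ end₁ e
  ... | yes _  = refl
  ... | no  ≢e = ⊥-elim (≢e refl)

  head-incident : ∀ s → Incident H G (head s) (edge s)
  head-incident s = joins⇒incident₂ (dart-joins s)

  module _ (matching : (x : Fin n) → PerfectMatchingAt H G c x) where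
    private
      module M (x : Fin n) = PerfectMatchingAt (matching x)

    partner : Dart → Fin m
    partner s = proj₁ (M.covers (head s) (edge s) (head-incident s))

    partner-matched : ∀ s → M.M (head s) (edge s) (partner s)
    partner-matched s = proj₂ (M.covers (head s) (edge s) (head-incident s))

    next : Dart → Dart
    next s = departing (partner s) (head s)

    partner-adjacent : ∀ s → AdjAt H G c (head s) (edge s) (partner s)
    partner-adjacent s = M.M-edge (head s) (partner-matched s)

    tail-next : ∀ s → tail (next s) ≡ head s
    tail-next s = let (_ , head∈partner , _ , _) = partner-adjacent s in tail-departing head∈partner

    edge-next-≢ : ∀ s → edge (next s) ≢ edge s
    edge-next-≢ s eq = let (_ , _ , edge≢partner , _) = partner-adjacent s in edge≢partner (sym eq)

    adjacent-next : ∀ s → E (c (edge s)) (c (edge (next s)))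
    adjacent-next s = let (_ , _ , _ , adjacent) = partner-adjacent s in adjacent

    -- Leaving along the partner of s and turning back, the matching at head s sends us along s again.
    next-reverse-next : ∀ s → next (reverse (next s)) ≡ reverse s
    next-reverse-next s = begin
      departing (partner (reverse (next s))) (head (reverse (next s))) ≡⟨ cong₂ departing partner-back head-back ⟩
      departing (edge s) (head s)                                    ≡⟨ departing-head s ⟩
      reverse s                                                      ∎
      where
      open ≡-Reasoning
      head-back : head (reverse (next s)) ≡ head s
      head-back = trans (head-reverse (next s)) (tail-next s)
      partner-back : partner (reverse (next s)) ≡ edge s
      partner-back = M.unique (head s)
        (subst (λ v → M.M v (partner s) (partner (reverse (next s)))) head-back (partner-matched (reverse (next s))))
        (M.M-sym (head s) (partner-matched s))

    next-injective : Injective _≡_ _≡_ next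
    next-injective {s} {t} eq = begin
      s                                 ≡⟨ sym (reverse-involutive s) ⟩
      reverse (reverse s)               ≡⟨ cong reverse (sym (next-reverse-next s)) ⟩
      reverse (next (reverse (next s))) ≡⟨ cong (reverse ∘ next ∘ reverse) eq ⟩
      reverse (next (reverse (next t))) ≡⟨ cong reverse (next-reverse-next t) ⟩
      reverse (reverse t)               ≡⟨ reverse-involutive t ⟩
      t                                 ∎
      where open ≡-Reasoning

    open Orbits dartCode next next-injective

    reverse-≢-iter : ∀ d s → reverse s ≢ iter d s
    reverse-≢-iter zero          s eq = reverse-≢ s eq
    reverse-≢-iter (suc zero)    s eq = edge-next-≢ s (cong edge (sym eq))
    reverse-≢-iter (suc (suc d)) s eq = reverse-≢-iter d (next s) (begin
      reverse (next s)  ≡⟨ next-injective (trans (next-reverse-next s) eq) ⟩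
      iter (suc d) s    ≡⟨ iter-suc d s ⟩
      iter d (next s)   ∎)
      where open ≡-Reasoning

    -- An edge met twice on a cycle is met either along the same dart, contradicting minimality of
    -- the period, or along both of its darts, which reverse-≢-iter rules out.
    edge-iter-≢ : ∀ s a d → suc d < period s → edge (iter a s) ≢ edge (iter (suc d) (iter a s))
    edge-iter-≢ s a d 1+d<p same with edge-≡ same
    ... | inj₁ returns  = iter-period-minimal s d 1+d<p (iter-injective a (trans (iter-comm a (suc d) s) returns))
    ... | inj₂ reverses = reverse-≢-iter (suc d) (iter a s) (sym reverses)

    edges-distinct : ∀ s {a b} → a < b → b < period s → edge (iter a s) ≢ edge (iter b s)
    edges-distinct s {a} {b} a<b b<p =
      subst (λ t → edge (iter a s) ≢ edge t) (sym iter-b) (edge-iter-≢ s a d (≤-<-trans 1+d≤b b<p))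
      where
      d = b ∸ suc a
      b≡1+d+a : b ≡ suc d + a
      b≡1+d+a = sym (trans (sym (+-suc d a)) (m∸n+n≡m a<b))
      1+d≤b : suc d ≤ b
      1+d≤b = subst (suc d ≤_) (sym b≡1+d+a) (m≤m+n (suc d) a)
      iter-b : iter b s ≡ iter (suc d) (iter a s)
      iter-b = trans (cong (λ l → iter l s) b≡1+d+a) (iter-+ (suc d) a s)

    trailFrom : Dart → ClosedHTrail H G c
    trailFrom s = record
      { k       = period s
      ; k≥1     = s≤s z≤n
      ; vs      = λ i → tail (iter (toℕ i) s)
      ; es      = λ i → edge (iter (toℕ i) s)
      ; joins   = joins-at
      ; hwalk   = λ i j j≡1+i → subst (λ l → E (c (edge (iter (toℕ i) s))) (c (edge (iter l s))))
                                      (sym j≡1+i) (adjacent-next (iter (toℕ i) s))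
      ; closedV = cong tail (sym (trans (cong (λ l → iter l s) (FP.toℕ-fromℕ (period s))) (iter-period s)))
      ; closedE = λ i₀ iₗ i₀≡0 1+iₗ≡k → subst (λ t → E (c (edge (iter (toℕ iₗ) s))) (c (edge t)))
                    (trans (cong (λ l → iter l s) 1+iₗ≡k) (trans (iter-period s) (cong (λ l → iter l s) (sym i₀≡0))))
                    (adjacent-next (iter (toℕ iₗ) s))
      ; trail   = <-distinct⇒injective (λ i → edge (iter (toℕ i) s)) (λ {i} {j} i<j → edges-distinct s i<j (FP.toℕ<n j))
      }
      where
      joins-at : (i : Fin (period s)) →
                 Joins H G (edge (iter (toℕ i) s)) (tail (iter (toℕ (inject₁ i)) s)) (tail (iter (suc (toℕ i)) s))
      joins-at i = subst (λ v → Joins H G (edge (iter (toℕ i) s)) v (tail (iter (suc (toℕ i)) s)))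
                         (cong (λ l → tail (iter l s)) (sym (FP.toℕ-inject₁ i)))
                         (subst (Joins H G (edge (iter (toℕ i) s)) (tail (iter (toℕ i) s)))
                                (sym (tail-next (iter (toℕ i) s))) (dart-joins (iter (toℕ i) s)))

    OnCycle : Dart → Fin m → Set
    OnCycle s e = ∃ λ k → edge (iter k s) ≡ e

    iter-reverse-iter : ∀ k s → iter k (reverse (iter k s)) ≡ reverse s
    iter-reverse-iter zero    s = refl
    iter-reverse-iter (suc k) s = begin
      iter (suc k) (reverse (next (iter k s)))  ≡⟨ iter-suc k (reverse (next (iter k s))) ⟩
      iter k (next (reverse (next (iter k s)))) ≡⟨ cong (iter k) (next-reverse-next (iter k s)) ⟩
      iter k (reverse (iter k s))               ≡⟨ iter-reverse-iter k s ⟩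
      reverse s                                 ∎
      where open ≡-Reasoning

    onCycle-reverse : ∀ {s e} → OnCycle s e → OnCycle (reverse s) e
    onCycle-reverse {s} (k , p) = pred (period r) * k , trans (cong edge back) p
      where
      r : Dart
      r = reverse (iter k s)
      back : iter (pred (period r) * k) (reverse s) ≡ r
      back = subst (λ t → iter (pred (period r) * k) t ≡ r) (iter-reverse-iter k s) (iter-return k r)

    onCycle-reorient : ∀ {s t e} → edge s ≡ edge t → OnCycle s e → OnCycle t e
    onCycle-reorient {e = e} same onS with edge-≡ same
    ... | inj₁ t≡s  = subst (λ u → OnCycle u e) (sym t≡s) onS
    ... | inj₂ t≡rs = subst (λ u → OnCycle u e) (sym t≡rs) (onCycle-reverse onS)

    SameTrail : Fin m → Fin m → Set
    SameTrail e = OnCycle (forward e)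

    onCycle-trans : ∀ {s e e′} → OnCycle s e → SameTrail e e′ → OnCycle s e′
    onCycle-trans {s} (k , p) e~e′ with onCycle-reorient {forward _} {iter k s} (sym p) e~e′
    ... | l , q = l + k , trans (cong edge (iter-+ l k s)) q

    sameTrail-sym : ∀ {e e′} → SameTrail e e′ → SameTrail e′ e
    sameTrail-sym {e} (k , p) = onCycle-reorient p (pred (period t) * k , cong edge (iter-return k (forward e)))
      where t = forward e

    sameTrail? : ∀ e e′ → Dec (SameTrail e e′)
    sameTrail? e e′ = any-iter? (λ t → edge t F.≟ e′) (forward e)

    onCycle⇔trailFrom : ∀ s e → OnCycle s e ⇔ ∃ λ i → ClosedHTrail.es (trailFrom s) i ≡ e
    onCycle⇔trailFrom s e = mk⇔ (λ (k , p) → let (i , eq) = iter-position k s in i , trans (cong edge (sym eq)) p)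
                                (λ (i , p) → toℕ i , p)

    IsRepresentative : Fin m → Set
    IsRepresentative r = ∀ e → e F.< r → ¬ SameTrail r e

    isRepresentative? : ∀ r → Dec (IsRepresentative r)
    isRepresentative? r = FP.all? (λ e → (e F.<? r) →-dec ¬? (sameTrail? r e))

    representative : ∀ e → ∃ λ r → SameTrail e r × IsRepresentative r
    representative e = r , e~r , least
      where
      smallest : ∃ λ r → ¬ ¬ SameTrail e r × ((e′ : F.Fin′ r) → ¬ SameTrail e (inject e′))
      smallest = FP.¬∀⟶∃¬-smallest m (λ e′ → ¬ SameTrail e e′) (λ e′ → ¬? (sameTrail? e e′)) (λ never → never e (0 , refl))
      r : Fin m
      r = proj₁ smallest
      e~r : SameTrail e r
      e~r = decidable-stable (sameTrail? e r) (proj₁ (proj₂ smallest))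
      least : IsRepresentative r
      least e′ e′<r r~e′ = proj₂ (proj₂ smallest) (fromℕ< e′<r)
        (subst (SameTrail e) (FP.toℕ-injective (sym (trans (FP.toℕ-inject (fromℕ< e′<r)) (FP.toℕ-fromℕ< e′<r))))
               (onCycle-trans e~r r~e′))

    representatives-unique : ∀ {r r′} → IsRepresentative r → IsRepresentative r′ → SameTrail r r′ → r ≡ r′
    representatives-unique {r} {r′} rep rep′ r~r′ with FP.<-cmp r r′
    ... | tri< r<r′ _ _ = ⊥-elim (rep′ r r<r′ (sameTrail-sym r~r′))
    ... | tri≈ _ r≡r′ _ = r≡r′
    ... | tri> _ _ r′<r = ⊥-elim (rep r′ r′<r r~r′)

    representatives : List (Fin m)
    representatives = filter isRepresentative? (allFin m)

    representative-∈ : ∀ j → IsRepresentative (lookup representatives j)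
    representative-∈ j = proj₂ (∈-filter⁻ isRepresentative? {xs = allFin m} (∈-lookup j))

    trails : Fin (length representatives) → ClosedHTrail H G c
    trails j = trailFrom (forward (lookup representatives j))

    matchings⇒partition : ClosedHTrailPartition H G c
    matchings⇒partition = record
      { p        = length representatives
      ; T        = trails
      ; cover    = cover
      ; disjoint = disjoint
      }
      where
      cover : ∀ e → ∃[ j ] ∃[ i ] ClosedHTrail.es (trails j) i ≡ e
      cover e = index r∈ , Equivalence.to (onCycle⇔trailFrom _ e) r~e
        where
        r : Fin m
        r = proj₁ (representative e)
        r∈ : r ∈ representatives
        r∈ = ∈-filter⁺ isRepresentative? (∈-allFin r) (proj₂ (proj₂ (representative e)))
        r~e : SameTrail (lookup representatives (index r∈)) e
        r~e = subst (λ r → SameTrail r e) (lookup-index r∈) (sameTrail-sym (proj₁ (proj₂ (representative e))))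

      disjoint : ∀ e j j′ i i′ → ClosedHTrail.es (trails j) i ≡ e → ClosedHTrail.es (trails j′) i′ ≡ e → j ≡ j′
      disjoint e j j′ i i′ p q = lookup-injective (Unique.filter⁺ isRepresentative? (Unique.allFin⁺ m))
        (representatives-unique (representative-∈ j) (representative-∈ j′)
          (onCycle-trans (Equivalence.from (onCycle⇔trailFrom _ e) (i , p))
                         (sameTrail-sym (Equivalence.from (onCycle⇔trailFrom _ e) (i′ , q)))))


corollary1 : ∀ {ℓv ℓe : Level} (H : LoopGraph ℓv ℓe) (G : Multigraph) (c : HColoring H G) →
    ((x : Fin (Multigraph.n G)) → PerfectMatchingAt H G c x) ⇔ ClosedHTrailPartition H G c
corollary1 H G c = mk⇔ (matchings⇒partition H G c) (partition⇒perfectMatching H G c)
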